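{- Let $r\ge 2$ and let $w=a_1^kva_1^m\in M_r$ with $k,m\ge0$, $|v|>0$, $v_1\ne a_1$ and $v_{fin}\ne a_1$. Then, up to equivalence (modulo bounded functions), \[\rho_w=\rho_v-\sum_{s\in S_r\setminus\{a_1\}}\sum_{i=0}^{k-1}\rho_{sa_1^iv}-\sum_{s\in S_r\setminus\{a_1\}}\sum_{j=0}^{m-1}\rho_{va_1^js}+\sum_{s_1,s_2\in S_r\setminus\{a_1\}}\sum_{i=0}^{k-1}\sum_{j=0}^{m-1}\rho_{s_1a_1^iva_1^js_2}.\]
   Context: $S_r=\{a_1,\dots,a_r\}$ and $M_r$ is the free monoid over $S_r$. For a word $u$, $\rho_u(w)$ is the number of (possibly overlapping) occurrences of $u$ as a contiguous subword of $w$, and $\rho_\epsilon(w)=|w|$. Two counting functions (finite linear combinations of the $\rho_u$) are equivalent if their difference is bounded on $M_r$. $v_1$ and $v_{fin}$ denote the first and last letters of $v$. -}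

module Defs where

open import Data.Nat using (ℕ; zero; suc; _≤_)
open import Data.Fin using (Fin)
open import Data.List using (List; []; _∷_; length; map; concatMap; replicate; _++_; upTo; allFin; foldr)
open import Data.Integer using (ℤ; +_; _+_; _-_; _*_; ∣_∣; -_)
open import Data.Product using (_×_; _,_; ∃)
open import Data.Bool using (Bool; true; false; _∧_)
open import Relation.Nullary.Decidable using (⌊_⌋)
import Data.Fin as F

-- Words over the alphabet S_r = Fin r (a_1 is Fin.zero)
Word : ℕ → Set
Word r = List (Fin r)

isPrefix : ∀ {r} → Word r → Word r → Bool
isPrefix [] _ = true
isPrefix (_ ∷ _) [] = false
isPrefix (x ∷ u) (y ∷ w) = ⌊ x F.≟ y ⌋ ∧ isPrefix u w

occ : ∀ {r} → Word r → Word r → ℕ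
occ u [] = 0
occ u (y ∷ w) with isPrefix u (y ∷ w)
... | true = suc (occ u w)
... | false = occ u w

ρ : ∀ {r} → Word r → Word r → ℕ
ρ [] w = length w
ρ u@(_ ∷ _) w = occ u w

-- counting functions: finite formal ℤ-linear combinations of the ρ_u
CountingFun : ℕ → Set
CountingFun r = List (ℤ × Word r)

eval : ∀ {r} → CountingFun r → Word r → ℤ
eval [] w = + 0
eval ((c , u) ∷ f) w = c * (+ ρ u w) + eval f w

_≈_ : ∀ {r} → CountingFun r → CountingFun r → Set
f ≈ g = ∃ λ (B : ℕ) → ∀ w → ∣ eval f w - eval g w ∣ ≤ B

_^'_ : ∀ {r} → Fin r → ℕ → Word r
a ^' n = replicate n a

-- the letters of S_r ∖ {a_1} when r = suc n, a_1 = zero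
others : ∀ {n} → List (Fin (suc n))
others = map F.suc (allFin _)

neg : ∀ {r} → CountingFun r → CountingFun r
neg = map (λ { (c , u) → (- c , u) })

{-# OPTIONS --safe #-}

-- Every occurrence of a nonempty word u in x, except one at the very start of x, is preceded by exactly one
-- letter, so ρ_u = Σ_a ρ_{au} + O(1); dually ρ_u = Σ_a ρ_{ua} + O(1). Splitting off a = a₁ and iterating k times
-- gives ρ_u = ρ_{a₁ᵏu} + Σ_{s≠a₁, i<k} ρ_{s a₁ⁱ u} + O(k), and similarly on the right. Applying the right
-- iteration to v and to every s a₁ⁱ v, and the left iteration to v a₁ᵐ, and eliminating, leaves
-- ρ_w minus the claimed combination as a difference of bounded error terms.
module Submission where

open import Defs
open import Data.Nat using (ℕ; zero; suc; _<_)
open import Data.Fin using (Fin)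
open import Data.List using (List; []; _∷_; length; map; concatMap; _++_; upTo; head; last)
open import Data.Maybe using (just)
open import Data.Integer using (+_; -[1+_])
open import Data.Product using (_,_)
open import Relation.Binary.PropositionalEquality using (_≡_; _≢_)

open import Data.Bool using (Bool; true; false; _∧_)
open import Data.Fin.Properties using (_≟_)
open import Data.Integer using (∣_∣; _⊖_)
import Data.Integer as ℤ
import Data.Integer.Properties as ℤ
open import Data.Integer.Tactic.RingSolver using () renaming (solve-∀ to ℤ-solve-∀)
open import Data.List using (allFin)
open import Data.List.Properties using (map-cong; map-∘; map-upTo; map-tabulate; ++-assoc; ++-identityʳ)
open import Data.Nat using (_+_; _*_; _≤_; z≤n; s≤s)
open import Data.Nat.ListAction using (sum)
open import Data.Nat.Properties
  using (+-commutativeSemigroup; <-irrefl; <-trans; n<1+n; +-comm; +-identityʳ; +-mono-≤; ≤-trans; ≤-reflexive;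
         module ≤-Reasoning)
open import Algebra.Properties.CommutativeSemigroup +-commutativeSemigroup using (interchange)
open import Data.Nat.Tactic.RingSolver using (solve-∀)
open import Relation.Binary.PropositionalEquality using (refl; sym; trans; cong; cong₂; subst; subst₂; module ≡-Reasoning)
open import Relation.Nullary.Decidable using (⌊_⌋; ⌊⌋-map′; yes)
open import Relation.Nullary.Negation using (contradiction)

private
  variable
    A B : Set
    n r : ℕ

iverson : Bool → ℕ
iverson true  = 1
iverson false = 0

iverson≤1 : ∀ b → iverson b ≤ 1
iverson≤1 true  = s≤s z≤n
iverson≤1 false = z≤n

∑ : List A → (A → ℕ) → ℕ
∑ xs f = sum (map f xs)

syntax ∑ xs (λ a → e) = ∑[ a ∈ xs ] e

∑-cong : ∀ xs {f g : A → ℕ} → (∀ a → f a ≡ g a) → ∑ xs f ≡ ∑ xs g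
∑-cong xs f≗g = cong sum (map-cong f≗g xs)

∑-zero : (xs : List A) → ∑[ a ∈ xs ] 0 ≡ 0
∑-zero []       = refl
∑-zero (_ ∷ xs) = ∑-zero xs

∑-distrib-+ : ∀ xs (f g : A → ℕ) → ∑[ a ∈ xs ] (f a + g a) ≡ ∑ xs f + ∑ xs g
∑-distrib-+ []       f g = refl
∑-distrib-+ (a ∷ xs) f g = begin
  f a + g a + ∑[ a ∈ xs ] (f a + g a)   ≡⟨ cong (_+_ (f a + g a)) (∑-distrib-+ xs f g) ⟩
  f a + g a + (∑ xs f + ∑ xs g)         ≡⟨ interchange (f a) (g a) (∑ xs f) (∑ xs g) ⟩
  f a + ∑ xs f + (g a + ∑ xs g)         ∎
  where open ≡-Reasoning

∑-comm : ∀ xs ys (f : A → B → ℕ) → ∑[ a ∈ xs ] ∑[ b ∈ ys ] f a b ≡ ∑[ b ∈ ys ] ∑[ a ∈ xs ] f a b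
∑-comm []       ys f = sym (∑-zero ys)
∑-comm (a ∷ xs) ys f = trans (cong (_+_ (∑ ys (f a))) (∑-comm xs ys f))
                             (sym (∑-distrib-+ ys (f a) (λ b → ∑[ a ∈ xs ] f a b)))

∑-map : ∀ (g : A → B) xs f → ∑ (map g xs) f ≡ ∑[ a ∈ xs ] f (g a)
∑-map g xs f = cong sum (sym (map-∘ xs))

∑-upTo-suc : ∀ k f → ∑ (upTo (suc k)) f ≡ f 0 + ∑[ i ∈ upTo k ] f (suc i)
∑-upTo-suc k f = trans (cong (λ is → f 0 + sum (map f is)) (sym (map-upTo suc k)))
                       (cong (_+_ (f 0)) (∑-map suc (upTo k) f))

∑-allFin-suc : ∀ n (f : Fin (suc n) → ℕ) → ∑ (allFin (suc n)) f ≡ f Fin.zero + ∑ others f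
∑-allFin-suc n f = cong (λ xs → f Fin.zero + sum (map f xs)) (sym (map-tabulate (λ i → i) Fin.suc))

∑-iverson-≟ : ∀ (y : Fin r) b → ∑[ a ∈ allFin r ] iverson (⌊ a ≟ y ⌋ ∧ b) ≡ iverson b
∑-iverson-≟ {suc r} y b = begin
  ∑[ a ∈ allFin (suc r) ] δ a                ≡⟨ ∑-allFin-suc r δ ⟩
  δ Fin.zero + ∑ others δ                    ≡⟨ cong (_+_ (δ Fin.zero)) (∑-map Fin.suc (allFin r) δ) ⟩
  δ Fin.zero + ∑[ a ∈ allFin r ] δ (Fin.suc a) ≡⟨ split y ⟩
  iverson b                                  ∎
  where
  open ≡-Reasoning
  δ : Fin (suc r) → ℕ
  δ a = iverson (⌊ a ≟ y ⌋ ∧ b)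
  split : ∀ y → iverson (⌊ Fin.zero ≟ y ⌋ ∧ b) + ∑[ a ∈ allFin r ] iverson (⌊ Fin.suc a ≟ y ⌋ ∧ b) ≡ iverson b
  split Fin.zero    = trans (cong (_+_ (iverson b)) (∑-zero (allFin r))) (+-identityʳ _)
  split (Fin.suc y) = trans (∑-cong (allFin r) (λ a → cong (λ t → iverson (t ∧ b)) (⌊⌋-map′ _ _ (a ≟ y))))
                            (∑-iverson-≟ y b)

infix 4 _∈_+_+[0,_]

record _∈_+_+[0,_] (a b c d : ℕ) : Set where
  constructor within
  field
    excess    : ℕ
    excess≤   : excess ≤ d
    decompose : a ≡ b + c + excess

∑-within : ∀ xs {f g h : A → ℕ} {d} → (∀ a → f a ∈ g a + h a +[0, d ]) →
           ∑ xs f ∈ ∑ xs g + ∑ xs h +[0, length xs * d ]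
∑-within []       _       = within 0 z≤n refl
∑-within (a ∷ xs) {f} {g} {h} f≈ with f≈ a | ∑-within xs f≈
... | within e e≤d eq | within es es≤ eqs =
  within (e + es) (+-mono-≤ e≤d es≤) (trans (cong₂ _+_ eq eqs) (regroup (g a) (h a) e (∑ xs g) (∑ xs h) es))
  where
  regroup : ∀ x y z u v w → x + y + z + (u + v + w) ≡ x + u + (y + v) + (z + w)
  regroup = solve-∀

within-zero : ∀ {a c d} → c ≡ 0 → a ∈ a + c +[0, d ]
within-zero {a} c≡0 = within 0 z≤n (sym (trans (+-identityʳ _) (trans (cong (_+_ a) c≡0) (+-identityʳ a))))

within-step : ∀ {a a′ b s ε t d} → a ≡ a′ + s + ε → ε ≤ 1 → a′ ∈ b + t +[0, d ] → a ∈ b + (s + t) +[0, suc d ]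
within-step {b = b} {s} {ε} {t} a≡ ε≤1 (within e e≤d a′≡) =
  within (ε + e) (+-mono-≤ ε≤1 e≤d) (trans a≡ (trans (cong (λ z → z + s + ε) a′≡) (regroup b t e s ε)))
  where
  regroup : ∀ b t e s ε → b + t + e + s + ε ≡ b + (s + t) + (ε + e)
  regroup = solve-∀

occ-[] : ∀ (w : Word r) → occ [] w ≡ length w
occ-[] []      = refl
occ-[] (_ ∷ w) = cong suc (occ-[] w)

ρ≗occ : ∀ (u w : Word r) → ρ u w ≡ occ u w
ρ≗occ []      w = sym (occ-[] w)
ρ≗occ (_ ∷ _) w = refl

occ-∷ : ∀ (u : Word r) y x → occ u (y ∷ x) ≡ iverson (isPrefix u (y ∷ x)) + occ u x
occ-∷ u y x with isPrefix u (y ∷ x)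
... | true  = refl
... | false = refl

∑-occ-∷ : ∀ (u : Word r) y x →
          ∑[ a ∈ allFin r ] occ (a ∷ u) (y ∷ x) ≡ iverson (isPrefix u x) + ∑[ a ∈ allFin r ] occ (a ∷ u) x
∑-occ-∷ {r} u y x = begin
  ∑[ a ∈ allFin r ] occ (a ∷ u) (y ∷ x)
    ≡⟨ ∑-cong (allFin r) (λ a → occ-∷ (a ∷ u) y x) ⟩
  ∑[ a ∈ allFin r ] (iverson (⌊ a ≟ y ⌋ ∧ isPrefix u x) + occ (a ∷ u) x)
    ≡⟨ ∑-distrib-+ (allFin r) _ _ ⟩
  ∑[ a ∈ allFin r ] iverson (⌊ a ≟ y ⌋ ∧ isPrefix u x) + ∑[ a ∈ allFin r ] occ (a ∷ u) x
    ≡⟨ cong (_+ _) (∑-iverson-≟ y (isPrefix u x)) ⟩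
  iverson (isPrefix u x) + ∑[ a ∈ allFin r ] occ (a ∷ u) x
    ∎
  where open ≡-Reasoning

occ-extendˡ : ∀ (c : Fin r) cs x →
              occ (c ∷ cs) x ≡ ∑[ a ∈ allFin r ] occ (a ∷ c ∷ cs) x + iverson (isPrefix (c ∷ cs) x)
occ-extendˡ {r} c cs []      = sym (trans (+-identityʳ _) (∑-zero (allFin r)))
occ-extendˡ {r} c cs (y ∷ x) = begin
  occ u (y ∷ x)                  ≡⟨ occ-∷ u y x ⟩
  first + occ u x                ≡⟨ cong (_+_ first) (occ-extendˡ c cs x) ⟩
  first + (shifted + later)      ≡⟨ +-comm first _ ⟩
  shifted + later + first        ≡⟨ cong (_+ first) (+-comm shifted later) ⟩
  later + shifted + first        ≡⟨ cong (_+ first) (sym (∑-occ-∷ u y x)) ⟩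
  ∑[ a ∈ allFin r ] occ (a ∷ u) (y ∷ x) + first ∎
  where
  open ≡-Reasoning
  u = c ∷ cs
  first = iverson (isPrefix u (y ∷ x))
  later = iverson (isPrefix u x)
  shifted = ∑[ a ∈ allFin r ] occ (a ∷ u) x

isEqual : Word r → Word r → Bool
isEqual []      []      = true
isEqual []      (_ ∷ _) = false
isEqual (_ ∷ _) []      = false
isEqual (c ∷ u) (y ∷ w) = ⌊ c ≟ y ⌋ ∧ isEqual u w

isEqual⇒≡ : ∀ (u w : Word r) → isEqual u w ≡ true → u ≡ w
isEqual⇒≡ []      []      _ = refl
isEqual⇒≡ (c ∷ u) (y ∷ w) eq with c ≟ y
... | yes refl = cong (c ∷_) (isEqual⇒≡ u w eq)

occAtEnd : Word r → Word r → ℕ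
occAtEnd p []      = 0
occAtEnd p (y ∷ x) = iverson (isEqual p (y ∷ x)) + occAtEnd p x

occAtEnd-short : ∀ (p x : Word r) → length x < length p → occAtEnd p x ≡ 0
occAtEnd-short p []      _ = refl
occAtEnd-short p (y ∷ x) x<p with isEqual p (y ∷ x) in eq
... | true  = contradiction x<p (<-irrefl (cong length (sym (isEqual⇒≡ p (y ∷ x) eq))))
... | false = occAtEnd-short p x (<-trans (n<1+n _) x<p)

occAtEnd≤1 : ∀ (p x : Word r) → occAtEnd p x ≤ 1
occAtEnd≤1 p []      = z≤n
occAtEnd≤1 p (y ∷ x) with isEqual p (y ∷ x) in eq
... | true  = ≤-reflexive (cong suc (occAtEnd-short p x (≤-reflexive (cong length (sym (isEqual⇒≡ p (y ∷ x) eq))))))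
... | false = occAtEnd≤1 p x

isPrefix-extendʳ : ∀ (p z : Word r) →
  ∑[ a ∈ allFin r ] iverson (isPrefix (p ++ a ∷ []) z) + iverson (isEqual p z) ≡ iverson (isPrefix p z)
isPrefix-extendʳ {r} []      []      = cong (_+ 1) (∑-zero (allFin r))
isPrefix-extendʳ         []      (y ∷ z) = trans (+-identityʳ _) (∑-iverson-≟ y true)
isPrefix-extendʳ {r} (c ∷ p) []      = trans (+-identityʳ _) (∑-zero (allFin r))
isPrefix-extendʳ {r} (c ∷ p) (y ∷ z) with ⌊ c ≟ y ⌋
... | true  = isPrefix-extendʳ p z
... | false = trans (+-identityʳ _) (∑-zero (allFin r))

occ-extendʳ : ∀ (p x : Word r) → occ p x ≡ ∑[ a ∈ allFin r ] occ (p ++ a ∷ []) x + occAtEnd p x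
occ-extendʳ {r} p []      = sym (trans (+-identityʳ _) (∑-zero (allFin r)))
occ-extendʳ {r} p (y ∷ x) = begin
  occ p (y ∷ x)
    ≡⟨ occ-∷ p y x ⟩
  iverson (isPrefix p (y ∷ x)) + occ p x
    ≡⟨ cong₂ _+_ (sym (isPrefix-extendʳ p (y ∷ x))) (occ-extendʳ p x) ⟩
  (∑[ a ∈ allFin r ] starts a + ends) + (∑[ a ∈ allFin r ] occ (p ++ a ∷ []) x + occAtEnd p x)
    ≡⟨ interchange (∑[ a ∈ allFin r ] starts a) ends _ _ ⟩
  (∑[ a ∈ allFin r ] starts a + ∑[ a ∈ allFin r ] occ (p ++ a ∷ []) x) + occAtEnd p (y ∷ x)
    ≡⟨ cong (_+ occAtEnd p (y ∷ x)) (sym (∑-distrib-+ (allFin r) starts (λ a → occ (p ++ a ∷ []) x))) ⟩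
  ∑[ a ∈ allFin r ] (starts a + occ (p ++ a ∷ []) x) + occAtEnd p (y ∷ x)
    ≡⟨ cong (_+ occAtEnd p (y ∷ x)) (∑-cong (allFin r) (λ a → sym (occ-∷ (p ++ a ∷ []) y x))) ⟩
  ∑[ a ∈ allFin r ] occ (p ++ a ∷ []) (y ∷ x) + occAtEnd p (y ∷ x)
    ∎
  where
  open ≡-Reasoning
  starts : Fin r → ℕ
  starts a = iverson (isPrefix (p ++ a ∷ []) (y ∷ x))
  ends = iverson (isEqual p (y ∷ x))

^'-snoc : ∀ (a : Fin r) i u → a ^' i ++ a ∷ u ≡ a ∷ a ^' i ++ u
^'-snoc a zero    u = refl
^'-snoc a (suc i) u = cong (a ∷_) (^'-snoc a i u)

-- Occurrences of s a₁ⁱ u (resp. u a₁ʲ s, s₁ a₁ⁱ u a₁ʲ s₂) with s, s₁, s₂ ≠ a₁ count the occurrences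
-- of u whose maximal run of a₁ on the left (resp. right, both sides) is short and not at the border.
occRunˡ : ℕ → Word (suc n) → Word (suc n) → ℕ
occRunˡ k u x = ∑[ s ∈ others ] ∑[ i ∈ upTo k ] occ (s ∷ (Fin.zero ^' i) ++ u) x

occRunʳ : ℕ → Word (suc n) → Word (suc n) → ℕ
occRunʳ m p x = ∑[ s ∈ others ] ∑[ j ∈ upTo m ] occ (p ++ (Fin.zero ^' j) ++ s ∷ []) x

occRun : ℕ → ℕ → Word (suc n) → Word (suc n) → ℕ
occRun k m u x = ∑[ s₁ ∈ others ] ∑[ s₂ ∈ others ] ∑[ i ∈ upTo k ] ∑[ j ∈ upTo m ]
  occ (s₁ ∷ (Fin.zero ^' i) ++ u ++ (Fin.zero ^' j) ++ s₂ ∷ []) x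

occRunˡ-suc : ∀ k (u : Word (suc n)) x →
              occRunˡ (suc k) u x ≡ ∑[ s ∈ others ] occ (s ∷ u) x + occRunˡ k (Fin.zero ∷ u) x
occRunˡ-suc {n} k u x = trans (∑-cong (others {n}) peel) (∑-distrib-+ (others {n}) _ _)
  where
  peel : ∀ s → ∑[ i ∈ upTo (suc k) ] occ (s ∷ (Fin.zero ^' i) ++ u) x
             ≡ occ (s ∷ u) x + ∑[ i ∈ upTo k ] occ (s ∷ (Fin.zero ^' i) ++ Fin.zero ∷ u) x
  peel s = trans (∑-upTo-suc k _)
                 (cong (_+_ (occ (s ∷ u) x))
                       (∑-cong (upTo k) (λ i → cong (λ w → occ (s ∷ w) x) (sym (^'-snoc Fin.zero i u)))))

occRunʳ-suc : ∀ m (p : Word (suc n)) x →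
              occRunʳ (suc m) p x ≡ ∑[ s ∈ others ] occ (p ++ s ∷ []) x + occRunʳ m (p ++ Fin.zero ∷ []) x
occRunʳ-suc {n} m p x = trans (∑-cong (others {n}) peel) (∑-distrib-+ (others {n}) _ _)
  where
  peel : ∀ s → ∑[ j ∈ upTo (suc m) ] occ (p ++ (Fin.zero ^' j) ++ s ∷ []) x
             ≡ occ (p ++ s ∷ []) x + ∑[ j ∈ upTo m ] occ ((p ++ Fin.zero ∷ []) ++ (Fin.zero ^' j) ++ s ∷ []) x
  peel s = trans (∑-upTo-suc m _)
                 (cong (_+_ (occ (p ++ s ∷ []) x))
                       (∑-cong (upTo m) (λ j → cong (λ w → occ w x) (sym (++-assoc p (Fin.zero ∷ []) _)))))

occ-padˡ : ∀ k (c : Fin (suc n)) cs x →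
           occ (c ∷ cs) x ∈ occ ((Fin.zero ^' k) ++ c ∷ cs) x + occRunˡ k (c ∷ cs) x +[0, k ]
occ-padˡ {n} zero c cs x = within-zero (∑-zero (others {n}))
occ-padˡ {n} (suc k) c cs x =
  subst₂ (λ b t → occ u x ∈ b + t +[0, suc k ])
         (cong (λ w → occ w x) (^'-snoc Fin.zero k u)) (sym (occRunˡ-suc k u x))
         (within-step split (iverson≤1 _) (occ-padˡ k Fin.zero u x))
  where
  u = c ∷ cs
  split : occ u x ≡ occ (Fin.zero ∷ u) x + ∑[ s ∈ others ] occ (s ∷ u) x + iverson (isPrefix u x)
  split = trans (occ-extendˡ c cs x) (cong (_+ iverson (isPrefix u x)) (∑-allFin-suc n _))

occ-padʳ : ∀ m (p : Word (suc n)) x → occ p x ∈ occ (p ++ (Fin.zero ^' m)) x + occRunʳ m p x +[0, m ]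
occ-padʳ {n} zero p x =
  subst (λ b → occ p x ∈ b + occRunʳ 0 p x +[0, 0 ]) (cong (λ w → occ w x) (sym (++-identityʳ p)))
        (within-zero (∑-zero (others {n})))
occ-padʳ {n} (suc m) p x =
  subst₂ (λ b t → occ p x ∈ b + t +[0, suc m ])
         (cong (λ w → occ w x) (++-assoc p (Fin.zero ∷ []) _)) (sym (occRunʳ-suc m p x))
         (within-step split (occAtEnd≤1 p x) (occ-padʳ m (p ++ Fin.zero ∷ []) x))
  where
  split : occ p x ≡ occ (p ++ Fin.zero ∷ []) x + ∑[ s ∈ others ] occ (p ++ s ∷ []) x + occAtEnd p x
  split = trans (occ-extendʳ p x) (cong (_+ occAtEnd p x) (∑-allFin-suc n _))

occRunˡ-padʳ : ∀ k m (u : Word (suc n)) x →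
  occRunˡ k u x ∈ occRunˡ k (u ++ (Fin.zero ^' m)) x + occRun k m u x +[0, length (others {n}) * (length (upTo k) * m) ]
occRunˡ-padʳ {n} k m u x =
  subst (λ t → occRunˡ k u x ∈ occRunˡ k (u ++ (Fin.zero ^' m)) x + t +[0, length (others {n}) * (length (upTo k) * m) ])
        (∑-cong (others {n}) (λ s → ∑-comm (upTo k) (others {n}) _))
        (∑-within (others {n}) (λ s → ∑-within (upTo k) (padded s)))
  where
  shift : ∀ s i t → occ (s ∷ ((Fin.zero ^' i) ++ u) ++ t) x ≡ occ (s ∷ (Fin.zero ^' i) ++ u ++ t) x
  shift s i t = cong (λ w → occ (s ∷ w) x) (++-assoc (Fin.zero ^' i) u t)
  padded : ∀ s i → occ (s ∷ (Fin.zero ^' i) ++ u) x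
                   ∈ occ (s ∷ (Fin.zero ^' i) ++ u ++ (Fin.zero ^' m)) x
                     + ∑[ s₂ ∈ others ] ∑[ j ∈ upTo m ] occ (s ∷ (Fin.zero ^' i) ++ u ++ (Fin.zero ^' j) ++ s₂ ∷ []) x
                     +[0, m ]
  padded s i = subst₂ (λ b t → occ (s ∷ (Fin.zero ^' i) ++ u) x ∈ b + t +[0, m ])
                      (shift s i _) (∑-cong (others {n}) (λ s₂ → ∑-cong (upTo m) (λ j → shift s i _)))
                      (occ-padʳ m (s ∷ (Fin.zero ^' i) ++ u) x)

eval-++ : ∀ (f g : CountingFun r) w → eval (f ++ g) w ≡ eval f w ℤ.+ eval g w
eval-++ []            g w = sym (ℤ.+-identityˡ _)
eval-++ ((c , u) ∷ f) g w =
  trans (cong (ℤ._+_ (c ℤ.* + ρ u w)) (eval-++ f g w)) (sym (ℤ.+-assoc (c ℤ.* + ρ u w) (eval f w) (eval g w)))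

*-pos-distrib : ∀ c m n → c ℤ.* + m ℤ.+ c ℤ.* + n ≡ c ℤ.* + (m + n)
*-pos-distrib c m n = trans (sym (ℤ.*-distribˡ-+ c (+ m) (+ n))) (cong (c ℤ.*_) (sym (ℤ.pos-+ m n)))

eval-map : ∀ c (u : A → Word r) xs w → eval (map (λ a → (c , u a)) xs) w ≡ c ℤ.* + ∑[ a ∈ xs ] occ (u a) w
eval-map c u []       w = sym (ℤ.*-zeroʳ c)
eval-map c u (a ∷ xs) w =
  trans (cong₂ ℤ._+_ (cong (λ t → c ℤ.* + t) (ρ≗occ (u a) w)) (eval-map c u xs w)) (*-pos-distrib c _ _)

eval-concatMap : ∀ c (g : A → CountingFun r) (N : A → ℕ) xs w →
                 (∀ a → eval (g a) w ≡ c ℤ.* + N a) → eval (concatMap g xs) w ≡ c ℤ.* + ∑ xs N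
eval-concatMap c g N []       w eval-g = sym (ℤ.*-zeroʳ c)
eval-concatMap c g N (a ∷ xs) w eval-g =
  trans (eval-++ (g a) (concatMap g xs) w)
        (trans (cong₂ ℤ._+_ (eval-g a) (eval-concatMap c g N xs w eval-g)) (*-pos-distrib c _ _))

leftRuns : ℕ → Word (suc n) → CountingFun (suc n)
leftRuns k v = concatMap (λ s → map (λ i → (-[1+ 0 ] , s ∷ (Fin.zero ^' i) ++ v)) (upTo k)) others

rightRuns : ℕ → Word (suc n) → CountingFun (suc n)
rightRuns m v = concatMap (λ s → map (λ j → (-[1+ 0 ] , v ++ (Fin.zero ^' j) ++ s ∷ [])) (upTo m)) others

runs : ℕ → ℕ → Word (suc n) → CountingFun (suc n)
runs k m v = concatMap (λ s₁ → concatMap (λ s₂ → concatMap (λ i → map (λ j →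
  (+ 1 , s₁ ∷ (Fin.zero ^' i) ++ v ++ (Fin.zero ^' j) ++ s₂ ∷ [])) (upTo m)) (upTo k)) others) others

eval-leftRuns : ∀ k (v : Word (suc n)) x → eval (leftRuns k v) x ≡ -[1+ 0 ] ℤ.* + occRunˡ k v x
eval-leftRuns {n} k v x = eval-concatMap -[1+ 0 ] _ _ (others {n}) x (λ s → eval-map -[1+ 0 ] _ (upTo k) x)

eval-rightRuns : ∀ m (v : Word (suc n)) x → eval (rightRuns m v) x ≡ -[1+ 0 ] ℤ.* + occRunʳ m v x
eval-rightRuns {n} m v x = eval-concatMap -[1+ 0 ] _ _ (others {n}) x (λ s → eval-map -[1+ 0 ] _ (upTo m) x)

eval-runs : ∀ k m (v : Word (suc n)) x → eval (runs k m v) x ≡ + 1 ℤ.* + occRun k m v x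
eval-runs {n} k m v x = eval-concatMap (+ 1) _ _ (others {n}) x (λ s₁ → eval-concatMap (+ 1) _ _ (others {n}) x (λ s₂ →
                      eval-concatMap (+ 1) _ _ (upTo k) x (λ i → eval-map (+ 1) _ (upTo m) x)))

eval-difference : ∀ k m (v : Word (suc n)) x →
  eval ((+ 1 , (Fin.zero ^' k) ++ v ++ (Fin.zero ^' m)) ∷ []) x
    ℤ.- eval ((+ 1 , v) ∷ (leftRuns k v ++ rightRuns m v ++ runs k m v)) x
  ≡ + (occ ((Fin.zero ^' k) ++ v ++ (Fin.zero ^' m)) x + occRunˡ k v x + occRunʳ m v x) ℤ.- + (occ v x + occRun k m v x)
eval-difference k m v x = begin
  (+ 1 ℤ.* + ρ w x ℤ.+ + 0) ℤ.- (+ 1 ℤ.* + ρ v x ℤ.+ eval (leftRuns k v ++ rightRuns m v ++ runs k m v) x)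
    ≡⟨ cong₂ ℤ._-_ (cong (λ t → + 1 ℤ.* + t ℤ.+ + 0) (ρ≗occ w x)) (cong₂ (λ t e → + 1 ℤ.* + t ℤ.+ e) (ρ≗occ v x) eval-blocks) ⟩
  (+ 1 ℤ.* + W ℤ.+ + 0) ℤ.- (+ 1 ℤ.* + V ℤ.+ (-[1+ 0 ] ℤ.* + L ℤ.+ (-[1+ 0 ] ℤ.* + R ℤ.+ + 1 ℤ.* + D)))
    ≡⟨ collect (+ W) (+ V) (+ L) (+ R) (+ D) ⟩
  (+ W ℤ.+ + L ℤ.+ + R) ℤ.- (+ V ℤ.+ + D)
    ≡⟨ cong₂ ℤ._-_ (sym (trans (ℤ.pos-+ (W + L) R) (cong (ℤ._+ + R) (ℤ.pos-+ W L)))) (sym (ℤ.pos-+ V D)) ⟩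
  + (W + L + R) ℤ.- + (V + D)
    ∎
  where
  open ≡-Reasoning
  w = (Fin.zero ^' k) ++ v ++ (Fin.zero ^' m)
  W = occ w x
  V = occ v x
  L = occRunˡ k v x
  R = occRunʳ m v x
  D = occRun k m v x
  eval-blocks : eval (leftRuns k v ++ rightRuns m v ++ runs k m v) x
                ≡ -[1+ 0 ] ℤ.* + L ℤ.+ (-[1+ 0 ] ℤ.* + R ℤ.+ + 1 ℤ.* + D)
  eval-blocks = trans (eval-++ (leftRuns k v) _ x)
                      (cong₂ ℤ._+_ (eval-leftRuns k v x)
                                   (trans (eval-++ (rightRuns m v) _ x) (cong₂ ℤ._+_ (eval-rightRuns m v x) (eval-runs k m v x))))
  collect : ∀ W V L R D → (+ 1 ℤ.* W ℤ.+ + 0) ℤ.- (+ 1 ℤ.* V ℤ.+ (-[1+ 0 ] ℤ.* L ℤ.+ (-[1+ 0 ] ℤ.* R ℤ.+ + 1 ℤ.* D)))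
                          ≡ (W ℤ.+ L ℤ.+ R) ℤ.- (V ℤ.+ D)
  collect = ℤ-solve-∀

∣-∣≤-of-balance : ∀ a b e e′ → a + e ≡ b + e′ → ∣ + a ℤ.- + b ∣ ≤ e′ + e
∣-∣≤-of-balance a b e e′ balance = begin
  ∣ + a ℤ.- + b ∣          ≡⟨ cong ∣_∣ (ℤ.m-n≡m⊖n a b) ⟩
  ∣ a ⊖ b ∣                ≡⟨ cong ∣_∣ (sym (ℤ.+-cancelˡ-⊖ e a b)) ⟩
  ∣ (e + a) ⊖ (e + b) ∣    ≡⟨ cong ∣_∣ (cong₂ _⊖_ (trans (+-comm e a) balance) (+-comm e b)) ⟩
  ∣ (b + e′) ⊖ (b + e) ∣   ≡⟨ cong ∣_∣ (ℤ.+-cancelˡ-⊖ b e′ e) ⟩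
  ∣ e′ ⊖ e ∣               ≡⟨ cong ∣_∣ (sym (ℤ.m-n≡m⊖n e′ e)) ⟩
  ∣ + e′ ℤ.- + e ∣         ≤⟨ ℤ.∣i-j∣≤∣i∣+∣j∣ (+ e′) (+ e) ⟩
  e′ + e                   ∎
  where open ≤-Reasoning

elimination-bound : ∀ {v v′ w l l′ r d d₁ d₂ d₃} →
  v ∈ v′ + r +[0, d₂ ] → v′ ∈ w + l′ +[0, d₁ ] → l ∈ l′ + d +[0, d₃ ] →
  ∣ + (w + l + r) ℤ.- + (v + d) ∣ ≤ d₃ + (d₁ + d₂)
elimination-bound {w = w} {l′ = l′} {r} {d} (within e₂ e₂≤ refl) (within e₁ e₁≤ refl) (within e₃ e₃≤ refl) =
  ≤-trans (∣-∣≤-of-balance _ (w + l′ + e₁ + r + e₂ + d) (e₁ + e₂) e₃ (balance w l′ r d e₁ e₂ e₃)) (+-mono-≤ e₃≤ (+-mono-≤ e₁≤ e₂≤))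
  where
  balance : ∀ w l′ r d e₁ e₂ e₃ → w + (l′ + d + e₃) + r + (e₁ + e₂) ≡ w + l′ + e₁ + r + e₂ + d + e₃
  balance = solve-∀

lemma3p1 : (n : ℕ) (k m : ℕ) (v : Word (suc (suc n))) →
    0 < length v →
    (∀ x → head v ≡ just x → x ≢ Fin.zero) →
    (∀ x → last v ≡ just x → x ≢ Fin.zero) →
    ((+ 1 , (Fin.zero ^' k) ++ v ++ (Fin.zero ^' m)) ∷ [])
      ≈
    ((+ 1 , v) ∷
      (concatMap (λ s → map (λ i → (-[1+ 0 ] , s ∷ (Fin.zero ^' i) ++ v)) (upTo k)) others
      ++ concatMap (λ s → map (λ j → (-[1+ 0 ] , v ++ (Fin.zero ^' j) ++ s ∷ [])) (upTo m)) others
      ++ concatMap (λ s₁ → concatMap (λ s₂ → concatMap (λ i → map (λ j →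
           (+ 1 , s₁ ∷ (Fin.zero ^' i) ++ v ++ (Fin.zero ^' j) ++ s₂ ∷ [])) (upTo m)) (upTo k)) others) others))
lemma3p1 n k m []       ()
lemma3p1 n k m (c ∷ vs) _ _ _ =
  length (others {suc n}) * (length (upTo k) * m) + (k + m) , λ x →
    ≤-trans (≤-reflexive (cong ∣_∣ (eval-difference k m v x)))
            (elimination-bound (occ-padʳ m v x) (occ-padˡ k c (vs ++ (Fin.zero ^' m)) x) (occRunˡ-padʳ k m v x))
  where
  v = c ∷ vs
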